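{- Let $P$ be a column-strict tableau of skew partition shape with entries from $[k]$, and let $b$ be an inner corner of $P$ at which it is permissible to begin a column slide. Then the tableau $T$ obtained from $P$ by the column slide beginning at $b$ is Knuth-equivalent to $P$.
   Context: Tableaux are column-strict fillings (rows weakly increasing, columns strictly increasing) of skew shapes $\lambda/\mu$, $\mu\subseteq\lambda$ partitions. An inner corner of $P$ is a cell of $\mu$ whose removal leaves a partition. The cross order on cells: $c\prec d$ if the cell $c$ lies in the same column as, or a column to the right of, $d$, and lies in a row above $d$. A column slide beginning at an inner corner $b$ moves an empty box $b$ through $P$: initially $b$ switches with the first $1$ greater than it in the cross order; then the empty box switches with the first $2$ greater than it in the cross order, and so on, concluding when the empty box switches with a $k$. It is permissible to begin a column slide at $b$ when there is a chain of entries, increasing in the cross order starting from $b$, labelled $1,2,\dots,k$. Two tableaux are Knuth-equivalent if one can be obtained from the other by jeu de taquin slides (equivalently, their column reading words, obtained by reading each column bottom to top, columns from left to right, are Knuth-equivalent words). -}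

module Defs where

open import Data.Nat using (ℕ; zero; suc; _≤_; _<_; _⊔_; _≤ᵇ_; _<ᵇ_)
open import Data.Bool using (Bool; true; false; _∧_; if_then_else_)
open import Data.List using (List; []; _∷_; _++_; upTo; reverse; concatMap; length; foldr)
open import Data.Product using (_×_; _,_; proj₁; proj₂; Σ; ∃)
open import Data.Sum using (_⊎_)
open import Relation.Nullary using (¬_)
open import Relation.Binary.PropositionalEquality using (_≡_; _≢_)
open import Relation.Binary.Construct.Closure.Equivalence using (EqClosure)

-- Cells: (row , column), rows numbered from 0 top to bottom (English
-- convention), columns from 0 left to right.

Cell : Set
Cell = ℕ × ℕ

row : Cell → ℕ
row = proj₁

col : Cell → ℕ
col = proj₂

-- A partition / diagram is given by its list of row lengths; row i has
-- length rowLen λ i (0 beyond the end of the list).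
rowLen : List ℕ → ℕ → ℕ
rowLen []       _       = 0
rowLen (x ∷ xs) zero    = x
rowLen (x ∷ xs) (suc i) = rowLen xs i

IsPartition : List ℕ → Set
IsPartition λ′ = ∀ i → rowLen λ′ (suc i) ≤ rowLen λ′ i

_∈D_ : Cell → List ℕ → Set
c ∈D λ′ = col c < rowLen λ′ (row c)

decRow : List ℕ → ℕ → List ℕ
decRow []             _       = []
decRow (zero  ∷ xs)   zero    = zero ∷ xs
decRow (suc x ∷ xs)   zero    = x ∷ xs
decRow (x ∷ xs)       (suc i) = x ∷ decRow xs i

-- A filling of a skew shape outer/inner; entry i j is the entry in row i,
-- column j (only meaningful on cells of the skew shape).

record Tableau : Set where
  field
    outer : List ℕ
    inner : List ℕ
    entry : ℕ → ℕ → ℕ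
open Tableau public

entryAt : Tableau → Cell → ℕ
entryAt P c = entry P (row c) (col c)

InShape : Tableau → Cell → Set
InShape P c = (rowLen (inner P) (row c) ≤ col c) × (col c < rowLen (outer P) (row c))

inShapeᵇ : Tableau → ℕ → ℕ → Bool
inShapeᵇ P i j = (rowLen (inner P) i ≤ᵇ j) ∧ (j <ᵇ rowLen (outer P) i)

IsSkewShape : Tableau → Set
IsSkewShape P = IsPartition (outer P) × IsPartition (inner P)
              × (∀ i → rowLen (inner P) i ≤ rowLen (outer P) i)

IsColumnStrict : Tableau → Set
IsColumnStrict P =
    (∀ i j j′ → InShape P (i , j) → InShape P (i , j′) → j < j′ → entry P i j ≤ entry P i j′)
  × (∀ i i′ j → InShape P (i , j) → InShape P (i′ , j) → i < i′ → entry P i j < entry P i′ j)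

EntriesIn : ℕ → Tableau → Set
EntriesIn k P = ∀ c → InShape P c → (1 ≤ entryAt P c) × (entryAt P c ≤ k)

IsInnerCorner : Tableau → Cell → Set
IsInnerCorner P b = (b ∈D inner P)
                  × (suc (col b) ≡ rowLen (inner P) (row b))
                  × IsPartition (decRow (inner P) (row b))

_≺_ : Cell → Cell → Set
c ≺ d = (col d ≤ col c) × (row c < row d)

PermissibleAt : ℕ → Tableau → Cell → Set
PermissibleAt k P b =
  Σ (ℕ → Cell) λ c → (c 0 ≡ b) ×
    (∀ m → m < k → (c m ≺ c (suc m)) × InShape P (c (suc m)) × (entryAt P (c (suc m)) ≡ suc m))

-- q is the first cell with entry v greater than p in the cross order.
-- (Cells with a given entry form a horizontal strip; "first" = rightmost.)
IsFirst : Tableau → ℕ → Cell → Cell → Set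
IsFirst P v p q =
  InShape P q × (entryAt P q ≡ v) × (p ≺ q) ×
  (∀ q′ → InShape P q′ → entryAt P q′ ≡ v → p ≺ q′ → col q′ ≤ col q)

-- T is the result of the column slide of P (entries in [k]) beginning at b.
-- path 0 = b, path (m+1) = the first (m+1) greater than path m; the empty
-- box moves along the path, so path m receives entry m+1, the new shape is
-- (cells of P ∪ {b}) ∖ {path k}, and all other entries are unchanged.
ColumnSlide : ℕ → Tableau → Cell → Tableau → Set
ColumnSlide k P b T =
  Σ (ℕ → Cell) λ path →
    (path 0 ≡ b)
  × (∀ m → m < k → IsFirst P (suc m) (path m) (path (suc m)))
  × (∀ c → InShape T c → ((InShape P c ⊎ c ≡ b) × c ≢ path k))
  × (∀ c → (InShape P c ⊎ c ≡ b) → c ≢ path k → InShape T c)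
  × (∀ m → m < k → entryAt T (path m) ≡ suc m)
  × (∀ c → InShape T c → (∀ m → m < k → c ≢ path m) → entryAt T c ≡ entryAt P c)

-- Column reading word: each column read bottom to top, columns left to right.

maxList : List ℕ → ℕ
maxList = foldr _⊔_ 0

readColumn : Tableau → ℕ → List ℕ
readColumn P j =
  concatMap (λ i → if inShapeᵇ P i j then entry P i j ∷ [] else [])
            (reverse (upTo (length (outer P))))

readingWord : Tableau → List ℕ
readingWord P = concatMap (readColumn P) (upTo (maxList (outer P)))

data KnuthStep : List ℕ → List ℕ → Set where
  knuth₁ : ∀ u v {x y z} → x ≤ y → y < z →
           KnuthStep (u ++ x ∷ z ∷ y ∷ v) (u ++ z ∷ x ∷ y ∷ v)
  knuth₂ : ∀ u v {x y z} → x < y → y ≤ z →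
           KnuthStep (u ++ y ∷ x ∷ z ∷ v) (u ++ y ∷ z ∷ x ∷ v)

KnuthEquivalent : List ℕ → List ℕ → Set
KnuthEquivalent = EqClosure KnuthStep

TabKnuthEquivalent : Tableau → Tableau → Set
TabKnuthEquivalent T P = KnuthEquivalent (readingWord T) (readingWord P)

{-# OPTIONS --safe #-}

-- Read both column reading words from right to left. The path b = p₀, p₁, …, p_k of the slide is met
-- in the order p₀, …, p_k; P carries m at p_m (p₀ is empty) and T carries m+1 at p_m (p_k is empty),
-- all other letters agree. Column insertion is a sequence of Knuth moves, and once p₀, …, p_j have
-- been read the suffixes of P and T are Knuth-equivalent to H · j⋯1 · W and H · (j+1)⋯1 · W for
-- one column H with entries above j+1. A letter read between p_j and p_{j+1} is never j+1 (column
-- strictness, and p_{j+1} is the first j+1 after p_j), so it bumps the same entry out of both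
-- columns; the path letters j+1 of P and j+2 of T both bump the least entry of H. At p_k all
-- entries are at most k, which forces H = [], and both suffixes become k⋯1 · W.

module Submission where

open import Defs
open import Data.Nat using (ℕ; zero; suc; _+_; _≤_; _<_; z≤n; s≤s; _≤′_; ≤′-refl; ≤′-step)
open import Data.Nat.Properties
open import Data.Bool using (true; false; if_then_else_)
open import Data.List using (List; []; _∷_; _++_; applyDownFrom; upTo; downFrom; concatMap; map; length; _∷ʳ_)
open import Data.List.Properties using (++-assoc; ++-identityʳ; concatMap-++; concatMap-map; concatMap-cong; upTo-∷ʳ; reverse-upTo)
open import Data.List.Relation.Unary.All as All using (All; []; _∷_)
import Data.List.Relation.Unary.All.Properties as All
open import Data.Product using (_×_; _,_; proj₁; proj₂; ∃; ∃₂)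
open import Data.Product.Properties using (≡-dec)
open import Data.Sum using (_⊎_; inj₁; inj₂)
open import Data.Unit using (⊤; tt)
open import Data.Empty using (⊥-elim)
open import Function using (_∘_)
open import Relation.Nullary using (¬_; Dec; _because_; yes; no)
open import Relation.Nullary.Reflects using (Reflects; ofʸ; ofⁿ; _×-reflects_)
open import Relation.Binary.Definitions using (tri<; tri≈; tri>)
open import Relation.Binary.PropositionalEquality
open import Relation.Binary.Construct.Closure.ReflexiveTransitive using (ε; _◅_; _◅◅_)
open import Relation.Binary.Construct.Closure.Symmetric using (fwd)
import Relation.Binary.Construct.Closure.Equivalence as EqClosure

infix 4 _≈_
_≈_ : List ℕ → List ℕ → Set
_≈_ = KnuthEquivalent

≈-sym : ∀ {u v} → u ≈ v → v ≈ u
≈-sym = EqClosure.symmetric KnuthStep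

≈-reflexive : ∀ {u v} → u ≡ v → u ≈ v
≈-reflexive refl = ε

KnuthStep-prefix : ∀ w {u v} → KnuthStep u v → KnuthStep (w ++ u) (w ++ v)
KnuthStep-prefix w (knuth₁ u v x≤y y<z) =
  subst₂ KnuthStep (++-assoc w u _) (++-assoc w u _) (knuth₁ (w ++ u) v x≤y y<z)
KnuthStep-prefix w (knuth₂ u v x<y y≤z) =
  subst₂ KnuthStep (++-assoc w u _) (++-assoc w u _) (knuth₂ (w ++ u) v x<y y≤z)

≈-prefix : ∀ w {u v} → u ≈ v → w ++ u ≈ w ++ v
≈-prefix w = EqClosure.gmap (w ++_) (KnuthStep-prefix w)

≈-cons : ∀ x {u v} → u ≈ v → x ∷ u ≈ x ∷ v
≈-cons x = ≈-prefix (x ∷ [])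

knuth₁-head : ∀ {x y z} v → x ≤ y → y < z → x ∷ z ∷ y ∷ v ≈ z ∷ x ∷ y ∷ v
knuth₁-head v x≤y y<z = fwd (knuth₁ [] v x≤y y<z) ◅ ε

knuth₂-head : ∀ {x y z} v → x < y → y ≤ z → y ∷ x ∷ z ∷ v ≈ y ∷ z ∷ x ∷ v
knuth₂-head v x<y y≤z = fwd (knuth₂ [] v x<y y≤z) ◅ ε

headOr : {A : Set} → A → List A → A
headOr d []      = d
headOr d (x ∷ _) = x

headOr-++ : {A : Set} (d : A) (xs ys : List A) → headOr d (xs ++ ys) ≡ headOr (headOr d ys) xs
headOr-++ d []       ys = refl
headOr-++ d (x ∷ xs) ys = refl

headOr-mono : ∀ xs {b b′} → b ≤ b′ → headOr b xs ≤ headOr b′ xs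
headOr-mono []      b≤b′ = b≤b′
headOr-mono (x ∷ _) _    = ≤-refl

-- A column of a tableau, read bottom to top, with all entries above b.
DecreasingAbove : ℕ → List ℕ → Set
DecreasingAbove b []       = ⊤
DecreasingAbove b (x ∷ xs) = headOr b xs < x × DecreasingAbove b xs

DecreasingAbove⇒≤headOr : ∀ {b} xs → DecreasingAbove b xs → b ≤ headOr b xs
DecreasingAbove⇒≤headOr []       _         = ≤-refl
DecreasingAbove⇒≤headOr (x ∷ xs) (lt , xs↓) = ≤-trans (DecreasingAbove⇒≤headOr xs xs↓) (<⇒≤ lt)

DecreasingAbove-weaken : ∀ {b b′} xs → b′ ≤ b → DecreasingAbove b xs → DecreasingAbove b′ xs
DecreasingAbove-weaken []       _    _          = tt
DecreasingAbove-weaken (x ∷ xs) b′≤b (lt , xs↓) =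
  ≤-<-trans (headOr-mono xs b′≤b) lt , DecreasingAbove-weaken xs b′≤b xs↓

DecreasingAbove-++ : ∀ {b} xs ys → DecreasingAbove (headOr b ys) xs → DecreasingAbove b ys →
                     DecreasingAbove b (xs ++ ys)
DecreasingAbove-++     []       ys _          ys↓ = ys↓
DecreasingAbove-++ {b} (x ∷ xs) ys (lt , xs↓) ys↓ =
  subst (_< x) (sym (headOr-++ b xs ys)) lt , DecreasingAbove-++ xs ys xs↓ ys↓

DecreasingAbove-headOr≤⇒[] : ∀ {b} xs → DecreasingAbove b xs → headOr b xs ≤ b → xs ≡ []
DecreasingAbove-headOr≤⇒[] []       _          _   = refl
DecreasingAbove-headOr≤⇒[] (x ∷ xs) (lt , xs↓) x≤b =
  ⊥-elim (<-irrefl refl (<-≤-trans (≤-<-trans (DecreasingAbove⇒≤headOr xs xs↓) lt) x≤b))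

headOr-All≤ : ∀ {b} xs → All (_≤ b) xs → headOr b xs ≤ b
headOr-All≤ []       _         = ≤-refl
headOr-All≤ (x ∷ xs) (x≤b ∷ _) = x≤b

countdown : ℕ → List ℕ
countdown = applyDownFrom suc

countdown-decreasing : ∀ n → DecreasingAbove 0 (countdown n)
countdown-decreasing zero          = tt
countdown-decreasing (suc zero)    = s≤s z≤n , tt
countdown-decreasing (suc (suc n)) = ≤-refl , countdown-decreasing (suc n)

headOr-countdown : ∀ n → headOr 0 (countdown n) ≡ n
headOr-countdown zero    = refl
headOr-countdown (suc n) = refl

countdown-split : ∀ {z j} → z < j → ∃ λ D →
  countdown j ≡ D ++ suc z ∷ countdown z × DecreasingAbove (suc z) D × headOr (suc z) D ≤ j
countdown-split {z} {suc j} (s≤s z≤j) with m≤n⇒m<n∨m≡n z≤j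
... | inj₂ refl = [] , refl , tt , ≤-refl
... | inj₁ z<j  with countdown-split z<j
...   | D , eq , D↓ , hd≤j = suc j ∷ D , cong (suc j ∷_) eq , (s≤s hd≤j , D↓) , ≤-refl

-- Column insertion as Knuth moves: x passes the entries of Cg (all larger
-- than y) by knuth₁, then y passes those of Cl (all smaller than x) by knuth₂.
pass-larger : ∀ {x y} Cg v → x ≤ y → DecreasingAbove y Cg → x ∷ Cg ++ y ∷ v ≈ Cg ++ x ∷ y ∷ v
pass-larger []            v _   _              = ε
pass-larger (c ∷ [])      v x≤y (y<c , _)      = knuth₁-head v x≤y y<c
pass-larger (c ∷ c′ ∷ Cg) v x≤y (c′<c , Cg↓) =
  knuth₁-head (Cg ++ _ ∷ v) (≤-trans x≤y (DecreasingAbove⇒≤headOr (c′ ∷ Cg) Cg↓)) c′<c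
  ◅◅ ≈-cons c (pass-larger (c′ ∷ Cg) v x≤y Cg↓)

pass-smaller : ∀ {b x y} Cl v → x ≤ y → DecreasingAbove b Cl → headOr b Cl < x →
               x ∷ y ∷ Cl ++ v ≈ x ∷ Cl ++ y ∷ v
pass-smaller []       v _   _            _   = ε
pass-smaller (c ∷ Cl) v x≤y (hd<c , Cl↓) c<x =
  ≈-sym (knuth₂-head (Cl ++ v) c<x x≤y)
  ◅◅ ≈-cons _ (pass-smaller Cl v (≤-trans (<⇒≤ c<x) x≤y) Cl↓ hd<c)

column-bump : ∀ {b x y} Cg Cl v → x ≤ y → DecreasingAbove y Cg →
              DecreasingAbove b Cl → headOr b Cl < x →
              x ∷ Cg ++ y ∷ Cl ++ v ≈ Cg ++ x ∷ Cl ++ y ∷ v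
column-bump Cg Cl v x≤y Cg↓ Cl↓ hd<x =
  pass-larger Cg (Cl ++ v) x≤y Cg↓ ◅◅ ≈-prefix Cg (pass-smaller Cl v x≤y Cl↓ hd<x)

data Insertion (b z : ℕ) : List ℕ → Set where
  on-top  : ∀ {C} → headOr b C < z → Insertion b z C
  bumping : ∀ {Cg y Cl} → z ≤ y → DecreasingAbove y Cg →
            DecreasingAbove b Cl → headOr b Cl < z → Insertion b z (Cg ++ y ∷ Cl)

insertion : ∀ {b z} C → DecreasingAbove b C → b < z → Insertion b z C
insertion []      _ b<z = on-top b<z
insertion {z = z} (h ∷ H) (hd<h , H↓) b<z with h <? z
... | yes h<z = on-top h<z
... | no  h≮z with insertion H H↓ b<z
...   | on-top hd<z = bumping {Cg = []} (≮⇒≥ h≮z) tt H↓ hd<z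
...   | bumping {Cg} {y} {Cl} z≤y Cg↓ Cl↓ hd<z =
  bumping {Cg = h ∷ Cg} z≤y (subst (_< h) (headOr-++ _ Cg (y ∷ Cl)) hd<h , Cg↓) Cl↓ hd<z

-- z occurs in the column H ++ countdown j, so inserting it bumps a copy of itself.
countdown-bump : ∀ {z j} H W → z < j → DecreasingAbove j H →
                 suc z ∷ H ++ countdown j ++ W ≈ H ++ countdown j ++ suc z ∷ W
countdown-bump {z} H W z<j H↓ with countdown-split z<j
... | D , eq , D↓ , hd≤j rewrite eq =
  subst₂ _≈_ (cong (suc z ∷_) (sym (regroup W))) (sym (regroup (suc z ∷ W)))
    (column-bump (H ++ D) (countdown z) W ≤-refl
       (DecreasingAbove-++ H D (DecreasingAbove-weaken H hd≤j H↓) D↓)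
       (countdown-decreasing z) (subst (_< suc z) (sym (headOr-countdown z)) ≤-refl))
  where
    regroup : ∀ V → H ++ (D ++ suc z ∷ countdown z) ++ V ≡ (H ++ D) ++ suc z ∷ countdown z ++ V
    regroup V = trans (cong (H ++_) (++-assoc D _ V)) (sym (++-assoc H D _))

bump-above-countdown : ∀ {n z y} Cg Cl W → z ≤ y → DecreasingAbove y Cg →
                       DecreasingAbove n Cl → headOr n Cl < z →
                       z ∷ (Cg ++ y ∷ Cl) ++ countdown n ++ W ≈ (Cg ++ z ∷ Cl) ++ countdown n ++ y ∷ W
bump-above-countdown {n} {z} {y} Cg Cl W z≤y Cg↓ Cl↓ hd<z =
  subst₂ _≈_ (cong (z ∷_) (sym (regroup y W))) (sym (regroup z (y ∷ W)))
    (column-bump Cg (Cl ++ countdown n) W z≤y Cg↓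
       (DecreasingAbove-++ Cl (countdown n) Cl↓′ (countdown-decreasing n))
       (subst (_< z) (sym (headOr-++ 0 Cl (countdown n))) hd<z′))
  where
    Cl↓′ : DecreasingAbove (headOr 0 (countdown n)) Cl
    Cl↓′ = subst (λ b → DecreasingAbove b Cl) (sym (headOr-countdown n)) Cl↓
    hd<z′ : headOr (headOr 0 (countdown n)) Cl < z
    hd<z′ = subst (λ b → headOr b Cl < z) (sym (headOr-countdown n)) hd<z
    regroup : ∀ x V → (Cg ++ x ∷ Cl) ++ countdown n ++ V ≡ Cg ++ x ∷ (Cl ++ countdown n) ++ V
    regroup x V = trans (++-assoc Cg (x ∷ Cl) _) (cong (λ t → Cg ++ x ∷ t) (sym (++-assoc Cl _ V)))

module SlideWords (k : ℕ) where

  ColumnForm : ℕ → List ℕ → List ℕ → Set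
  ColumnForm j u v = ∃₂ λ H W → DecreasingAbove (suc j) H × All (_≤ k) H
                   × u ≈ H ++ countdown j ++ W × v ≈ H ++ countdown (suc j) ++ W

  insert-small : ∀ {j z u v} → z < j → ColumnForm j u v → ColumnForm j (suc z ∷ u) (suc z ∷ v)
  insert-small {j} {z} z<j (H , W , H↓ , H≤k , u≈ , v≈) =
    H , suc z ∷ W , H↓ , H≤k ,
    ≈-cons _ u≈ ◅◅ countdown-bump H W z<j (DecreasingAbove-weaken H (n≤1+n j) H↓) ,
    ≈-cons _ v≈ ◅◅ countdown-bump H W (m<n⇒m<1+n z<j) H↓

  insert-large : ∀ {j z u v} → suc j < z → z ≤ k → ColumnForm j u v → ColumnForm j (z ∷ u) (z ∷ v)
  insert-large {j} {z} j+1<z z≤k (H , W , H↓ , H≤k , u≈ , v≈) with insertion H H↓ j+1<z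
  ... | on-top hd<z = z ∷ H , W , (hd<z , H↓) , z≤k ∷ H≤k , ≈-cons z u≈ , ≈-cons z v≈
  ... | bumping {Cg} {y} {Cl} z≤y Cg↓ Cl↓ hd<z =
    Cg ++ z ∷ Cl , y ∷ W ,
    DecreasingAbove-++ Cg (z ∷ Cl) (DecreasingAbove-weaken Cg z≤y Cg↓) (hd<z , Cl↓) ,
    All.++⁺ (All.++⁻ˡ Cg H≤k) (z≤k ∷ All.tail (All.++⁻ʳ Cg H≤k)) ,
    ≈-cons z u≈ ◅◅ bump-above-countdown Cg Cl W z≤y Cg↓ (DecreasingAbove-weaken Cl (n≤1+n j) Cl↓)
                     (≤-<-trans (headOr-mono Cl (n≤1+n j)) hd<z) ,
    ≈-cons z v≈ ◅◅ bump-above-countdown Cg Cl W z≤y Cg↓ Cl↓ hd<z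

  insert-path : ∀ {j u v} → ColumnForm j u v → ColumnForm (suc j) (suc j ∷ u) (suc (suc j) ∷ v)
  insert-path {j} (H , W , H↓ , H≤k , u≈ , v≈) with insertion H H↓ (n<1+n (suc j))
  ... | on-top hd<z with DecreasingAbove-headOr≤⇒[] H H↓ (m<1+n⇒m≤n hd<z)
  ...   | refl = [] , W , tt , [] , ≈-cons _ u≈ , ≈-cons _ v≈
  insert-path {j} (_ , W , _ , H≤k , u≈ , v≈) | bumping {Cg} {y} {Cl} z≤y Cg↓ Cl↓ hd<z
    with DecreasingAbove-headOr≤⇒[] Cl Cl↓ (m<1+n⇒m≤n hd<z)
  ... | refl =
    Cg , y ∷ W , DecreasingAbove-weaken Cg z≤y Cg↓ , All.++⁻ˡ Cg H≤k ,
    ≈-cons _ u≈ ◅◅ bump-above-countdown Cg [] W (≤-trans (n≤1+n _) z≤y) Cg↓ tt ≤-refl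
                ◅◅ ≈-reflexive (++-assoc Cg (suc j ∷ []) _) ,
    ≈-cons _ v≈ ◅◅ bump-above-countdown Cg [] W z≤y Cg↓ tt ≤-refl
                ◅◅ ≈-reflexive (++-assoc Cg (suc (suc j) ∷ []) _)

  ColumnForm-last : ∀ {j u v} → ColumnForm j u v → suc j ≡ k → suc j ∷ u ≈ v
  ColumnForm-last (H , W , H↓ , H≤k , u≈ , v≈) refl
    with DecreasingAbove-headOr≤⇒[] H H↓ (headOr-All≤ H H≤k)
  ... | refl = ≈-cons _ u≈ ◅◅ ≈-sym v≈

  insert-letter : ∀ {j z u v} → 1 ≤ z → z ≤ k → z ≢ suc j →
                  ColumnForm j u v → ColumnForm j (z ∷ u) (z ∷ v)
  insert-letter {j} {suc z} _ z≤k z≢ cf with <-cmp z j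
  ... | tri< z<j _ _ = insert-small z<j cf
  ... | tri≈ _ refl _ = ⊥-elim (z≢ refl)
  ... | tri> _ _ j<z = insert-large (s≤s j<z) z≤k cf

  -- Stage n relates suffixes of the reading words of P and T, read from the right, that contain
  -- exactly the path cells p₀, …, p_{n-1}.
  data Stage : ℕ → List ℕ → List ℕ → Set where
    before : ∀ {u v} → u ≈ v → Stage 0 u v
    during : ∀ {j u v} → j < k → ColumnForm j u v → Stage (suc j) u v
    after  : ∀ {u v} → u ≈ v → Stage (suc k) u v

  Stage-after : ∀ {u v} → Stage (suc k) u v → u ≈ v
  Stage-after (during k<k _) = ⊥-elim (<-irrefl refl k<k)
  Stage-after (after u≈v)    = u≈v

  Admissible : ℕ → ℕ → Set
  Admissible zero    z = ⊤
  Admissible (suc j) z = j < k → 1 ≤ z × z ≤ k × z ≢ suc j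

  stage-letter : ∀ {n u v} z → Admissible n z → Stage n u v → Stage n (z ∷ u) (z ∷ v)
  stage-letter z _   (before u≈v) = before (≈-cons z u≈v)
  stage-letter z adm (during j<k cf) with adm j<k
  ... | 1≤z , z≤k , z≢ = during j<k (insert-letter 1≤z z≤k z≢ cf)
  stage-letter z _   (after u≈v)  = after (≈-cons z u≈v)

  pathLetterP : ℕ → List ℕ
  pathLetterP zero    = []
  pathLetterP (suc n) = suc n ∷ []

  pathLetterT : ℕ → List ℕ
  pathLetterT n with n ≟ k
  ... | yes _ = []
  ... | no  _ = suc n ∷ []

  stage-path : ∀ {n u v} → n ≤ k → Stage n u v →
               Stage (suc n) (pathLetterP n ++ u) (pathLetterT n ++ v)
  stage-path {zero} _ (before u≈v) with 0 ≟ k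
  ... | yes refl = after u≈v
  ... | no  0≢k  = during (≤∧≢⇒< z≤n 0≢k) ([] , _ , tt , [] , u≈v , ε)
  stage-path {suc j} j<k (during _ cf) with suc j ≟ k
  ... | yes refl = after (ColumnForm-last cf refl)
  ... | no  j+1≢k = during (≤∧≢⇒< j<k j+1≢k) (insert-path cf)
  stage-path k+1≤k (after _) = ⊥-elim (<-irrefl refl k+1≤k)

inShape-reflects : ∀ X c → Reflects (InShape X c) (inShapeᵇ X (row c) (col c))
inShape-reflects X c = ≤ᵇ-reflects-≤ _ _ ×-reflects <ᵇ-reflects-< _ _

cellWord : Tableau → Cell → List ℕ
cellWord X c = if inShapeᵇ X (row c) (col c) then entryAt X c ∷ [] else []

InShape? : ∀ X c → Dec (InShape X c)
InShape? X c = _ because inShape-reflects X c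

cellWord-in : ∀ X c → InShape X c → cellWord X c ≡ entryAt X c ∷ []
cellWord-in X c c∈X with inShapeᵇ X (row c) (col c) | inShape-reflects X c
... | true  | _        = refl
... | false | ofⁿ c∉X = ⊥-elim (c∉X c∈X)

cellWord-out : ∀ X c → ¬ InShape X c → cellWord X c ≡ []
cellWord-out X c c∉X with inShapeᵇ X (row c) (col c) | inShape-reflects X c
... | true  | ofʸ c∈X = ⊥-elim (c∉X c∈X)
... | false | _        = refl

rowLen>0⇒<length : ∀ l i → 0 < rowLen l i → i < length l
rowLen>0⇒<length (x ∷ l) zero    _ = s≤s z≤n
rowLen>0⇒<length (x ∷ l) (suc i) p = s≤s (rowLen>0⇒<length l i p)

rowLen≤maxList : ∀ l i → rowLen l i ≤ maxList l
rowLen≤maxList []      i       = z≤n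
rowLen≤maxList (x ∷ l) zero    = m≤m⊔n x (maxList l)
rowLen≤maxList (x ∷ l) (suc i) = ≤-trans (rowLen≤maxList l i) (m≤n⊔m x (maxList l))

InShape⇒row<length : ∀ X c → InShape X c → row c < length (outer X)
InShape⇒row<length X c (_ , c<len) = rowLen>0⇒<length (outer X) (row c) (≤-<-trans z≤n c<len)

InShape⇒col<maxList : ∀ X c → InShape X c → col c < maxList (outer X)
InShape⇒col<maxList X c (_ , c<len) = <-≤-trans c<len (rowLen≤maxList (outer X) (row c))

concatMap-concatMap : {A B C : Set} (f : B → List C) (g : A → List B) (xs : List A) →
                      concatMap f (concatMap g xs) ≡ concatMap (concatMap f ∘ g) xs
concatMap-concatMap f g []       = refl
concatMap-concatMap f g (x ∷ xs) =
  trans (concatMap-++ f (g x) _) (cong (concatMap f (g x) ++_) (concatMap-concatMap f g xs))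

columnCells : ℕ → ℕ → List Cell
columnCells R j = map (_, j) (downFrom R)

columnWord : Tableau → ℕ → ℕ → List ℕ
columnWord X R j = concatMap (cellWord X) (columnCells R j)

boxCells : ℕ → ℕ → List Cell
boxCells R N = concatMap (columnCells R) (upTo N)

boxWord : Tableau → ℕ → ℕ → List ℕ
boxWord X R N = concatMap (cellWord X) (boxCells R N)

columnWord-pad : ∀ X {R} j → length (outer X) ≤′ R →
                 columnWord X R j ≡ columnWord X (length (outer X)) j
columnWord-pad X j ≤′-refl              = refl
columnWord-pad X j (≤′-step {R} len≤R) =
  trans (cong (_++ columnWord X R j) (cellWord-out X (R , j) R∉X)) (columnWord-pad X j len≤R)
  where
    R∉X : ¬ InShape X (R , j)
    R∉X R∈X = <-irrefl refl (<-≤-trans (InShape⇒row<length X (R , j) R∈X) (≤′⇒≤ len≤R))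

columnWord-empty : ∀ X R {j} → maxList (outer X) ≤ j → columnWord X R j ≡ []
columnWord-empty X zero    _             = refl
columnWord-empty X (suc R) {j} max≤j =
  trans (cong (_++ columnWord X R j) (cellWord-out X (R , j) R∉X)) (columnWord-empty X R max≤j)
  where
    R∉X : ¬ InShape X (R , j)
    R∉X R∈X = <-irrefl refl (<-≤-trans (InShape⇒col<maxList X (R , j) R∈X) max≤j)

readColumn≡columnWord : ∀ X j → readColumn X j ≡ columnWord X (length (outer X)) j
readColumn≡columnWord X j =
  trans (cong (concatMap (λ i → cellWord X (i , j))) (reverse-upTo (length (outer X))))
        (sym (concatMap-map (cellWord X) (_, j) (downFrom (length (outer X)))))

columnWords-pad : ∀ X R {N} → maxList (outer X) ≤′ N →
                  concatMap (columnWord X R) (upTo N) ≡ concatMap (columnWord X R) (upTo (maxList (outer X)))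
columnWords-pad X R ≤′-refl               = refl
columnWords-pad X R (≤′-step {N} max≤N) = begin
  words (upTo (suc N))                      ≡⟨ cong words (upTo-∷ʳ N) ⟨
  words (upTo N ∷ʳ N)                       ≡⟨ concatMap-++ (columnWord X R) (upTo N) (N ∷ []) ⟩
  words (upTo N) ++ columnWord X R N ++ []  ≡⟨ cong (λ w → words (upTo N) ++ w ++ []) column-N-empty ⟩
  words (upTo N) ++ []                      ≡⟨ ++-identityʳ _ ⟩
  words (upTo N)                            ≡⟨ columnWords-pad X R max≤N ⟩
  words (upTo (maxList (outer X)))          ∎
  where
    open ≡-Reasoning
    words : List ℕ → List ℕ
    words = concatMap (columnWord X R)
    column-N-empty : columnWord X R N ≡ []
    column-N-empty = columnWord-empty X R (≤′⇒≤ max≤N)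

readingWord≡boxWord : ∀ X {R N} → length (outer X) ≤ R → maxList (outer X) ≤ N →
                      readingWord X ≡ boxWord X R N
readingWord≡boxWord X {R} {N} len≤R max≤N = begin
  readingWord X                                          ≡⟨ concatMap-cong column (upTo (maxList (outer X))) ⟩
  concatMap (columnWord X R) (upTo (maxList (outer X)))  ≡⟨ columnWords-pad X R (≤⇒≤′ max≤N) ⟨
  concatMap (columnWord X R) (upTo N)                    ≡⟨ concatMap-concatMap (cellWord X) (columnCells R) (upTo N) ⟨
  boxWord X R N                                          ∎
  where
    open ≡-Reasoning
    column : ∀ j → readColumn X j ≡ columnWord X R j
    column j = trans (readColumn≡columnWord X j) (sym (columnWord-pad X j (≤⇒≤′ len≤R)))

infix 4 _<r_ _≤r_

-- c is read before d in the column reading word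
_<r_ : Cell → Cell → Set
c <r d = col c < col d ⊎ (col c ≡ col d × row d < row c)

_≤r_ : Cell → Cell → Set
c ≤r d = col c < col d ⊎ (col c ≡ col d × row d ≤ row c)

≤r-refl : ∀ {c} → c ≤r c
≤r-refl = inj₂ (refl , ≤-refl)

<r⇒≤r : ∀ {c d} → c <r d → c ≤r d
<r⇒≤r (inj₁ lt)        = inj₁ lt
<r⇒≤r (inj₂ (eq , lt)) = inj₂ (eq , <⇒≤ lt)

≤r⇒col≤ : ∀ {c d} → c ≤r d → col c ≤ col d
≤r⇒col≤ (inj₁ lt)       = <⇒≤ lt
≤r⇒col≤ (inj₂ (eq , _)) = ≤-reflexive eq

<r-≤r-trans : ∀ {a b c} → a <r b → b ≤r c → a <r c
<r-≤r-trans (inj₁ x)        (inj₁ y)         = inj₁ (<-trans x y)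
<r-≤r-trans (inj₁ x)        (inj₂ (e , _))   = inj₁ (subst (_ <_) e x)
<r-≤r-trans (inj₂ (e , _))  (inj₁ y)         = inj₁ (subst (_< _) (sym e) y)
<r-≤r-trans (inj₂ (e , l))  (inj₂ (e′ , l′)) = inj₂ (trans e e′ , ≤-<-trans l′ l)

<r-trans : ∀ {a b c} → a <r b → b <r c → a <r c
<r-trans a<b b<c = <r-≤r-trans a<b (<r⇒≤r b<c)

<r⇒≱r : ∀ {c d} → c <r d → ¬ d ≤r c
<r⇒≱r (inj₁ x)       (inj₁ y)         = <-asym x y
<r⇒≱r (inj₁ x)       (inj₂ (e , _))   = <-irrefl (sym e) x
<r⇒≱r (inj₂ (e , _)) (inj₁ y)         = <-irrefl (sym e) y
<r⇒≱r (inj₂ (e , l)) (inj₂ (e′ , l′)) = <-irrefl refl (<-≤-trans l l′)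

<r⇒≢ : ∀ {c d} → c <r d → c ≢ d
<r⇒≢ c<d refl = <r⇒≱r c<d ≤r-refl

-- Cells in rows 0 … r; next c is the cell read right after c.
module ReadingBox (r : ℕ) where

  next : Cell → Cell
  next (zero  , j) = r , suc j
  next (suc i , j) = i , j

  <r-next : ∀ c → c <r next c
  <r-next (zero  , j) = inj₁ ≤-refl
  <r-next (suc i , j) = inj₂ (refl , ≤-refl)

  ≤r⇒≡⊎next≤r : ∀ c {q} → c ≤r q → row q ≤ r → c ≡ q ⊎ next c ≤r q
  ≤r⇒≡⊎next≤r (zero , j) (inj₁ j<q) q≤r with m≤n⇒m<n∨m≡n j<q
  ... | inj₁ j+1<q = inj₂ (inj₁ j+1<q)
  ... | inj₂ j+1≡q = inj₂ (inj₂ (j+1≡q , q≤r))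
  ≤r⇒≡⊎next≤r (zero , j) (inj₂ (j≡q , q≤0)) _ = inj₁ (cong₂ _,_ (sym (n≤0⇒n≡0 q≤0)) j≡q)
  ≤r⇒≡⊎next≤r (suc i , j) (inj₁ j<q) _ = inj₂ (inj₁ j<q)
  ≤r⇒≡⊎next≤r (suc i , j) (inj₂ (j≡q , q≤i+1)) _ with m≤n⇒m<n∨m≡n q≤i+1
  ... | inj₁ q<i+1 = inj₂ (inj₂ (j≡q , m<1+n⇒m≤n q<i+1))
  ... | inj₂ q≡i+1 = inj₁ (cong₂ _,_ (sym q≡i+1) j≡q)

  Contiguous : Cell → List Cell → Set
  Contiguous e []      = ⊤
  Contiguous e (c ∷ L) = next c ≡ headOr e L × Contiguous e L

  Contiguous-++ : ∀ {e} L M → Contiguous (headOr e M) L → Contiguous e M → Contiguous e (L ++ M)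
  Contiguous-++     []      M _         M↑ = M↑
  Contiguous-++ {e} (c ∷ L) M (c→ , L↑) M↑ =
    trans c→ (sym (headOr-++ e L M)) , Contiguous-++ L M L↑ M↑

  columnCells-contiguous : ∀ j n → Contiguous (r , suc j) (columnCells n j)
  columnCells-contiguous j zero          = tt
  columnCells-contiguous j (suc zero)    = refl , tt
  columnCells-contiguous j (suc (suc n)) = refl , columnCells-contiguous j (suc n)

  boxCells-suc : ∀ N → boxCells (suc r) (suc N) ≡ boxCells (suc r) N ++ columnCells (suc r) N
  boxCells-suc N = begin
    concatMap (columnCells (suc r)) (upTo (suc N))     ≡⟨ cong (concatMap (columnCells (suc r))) (upTo-∷ʳ N) ⟨
    concatMap (columnCells (suc r)) (upTo N ∷ʳ N)      ≡⟨ concatMap-++ (columnCells (suc r)) (upTo N) (N ∷ []) ⟩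
    boxCells (suc r) N ++ columnCells (suc r) N ++ []  ≡⟨ cong (boxCells (suc r) N ++_) (++-identityʳ _) ⟩
    boxCells (suc r) N ++ columnCells (suc r) N        ∎
    where open ≡-Reasoning

  boxCells-contiguous : ∀ N → Contiguous (r , N) (boxCells (suc r) N)
                            × headOr (r , N) (boxCells (suc r) N) ≡ (r , 0)
  boxCells-contiguous zero    = tt , refl
  boxCells-contiguous (suc N) =
    subst (λ L → Contiguous (r , suc N) L × headOr (r , suc N) L ≡ (r , 0)) (sym (boxCells-suc N))
      ( Contiguous-++ (boxCells (suc r) N) (columnCells (suc r) N) (proj₁ (boxCells-contiguous N))
                      (columnCells-contiguous N (suc r))
      , trans (headOr-++ _ (boxCells (suc r) N) (columnCells (suc r) N)) (proj₂ (boxCells-contiguous N)))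

rowLen-antitone : ∀ l → IsPartition l → ∀ {i i′} → i ≤ i′ → rowLen l i′ ≤ rowLen l i
rowLen-antitone l part {i} {zero}   z≤n = ≤-refl
rowLen-antitone l part {i} {suc i′} i≤i′+1 with m≤n⇒m<n∨m≡n i≤i′+1
... | inj₁ i<i′+1 = ≤-trans (part i′) (rowLen-antitone l part (m<1+n⇒m≤n i<i′+1))
... | inj₂ refl   = ≤-refl

∉-NW-of-inner : ∀ {P c d} → IsPartition (inner P) → c ∈D inner P →
                row d ≤ row c → col d ≤ col c → ¬ InShape P d
∉-NW-of-inner {P} part c∈μ rd≤rc cd≤cc (μ≤cd , _) =
  <-irrefl refl (≤-<-trans (≤-trans μ≤cd cd≤cc) (<-≤-trans c∈μ (rowLen-antitone (inner P) part rd≤rc)))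

InShape-fill : ∀ {P i i′ j j′} → IsSkewShape P → InShape P (i , j) → InShape P (i′ , j′) →
               i ≤ i′ → j ≤ j′ → InShape P (i , j′)
InShape-fill {P} (outer-part , _ , _) (μ≤j , _) (_ , j′<λ) i≤i′ j≤j′ =
  ≤-trans μ≤j j≤j′ , <-≤-trans j′<λ (rowLen-antitone (outer P) outer-part i≤i′)

entry-row-mono : ∀ {P i j j′} → IsColumnStrict P → InShape P (i , j) → InShape P (i , j′) → j ≤ j′ →
                 entry P i j ≤ entry P i j′
entry-row-mono (rows , _) ij∈P ij′∈P j≤j′ with m≤n⇒m<n∨m≡n j≤j′
... | inj₁ j<j′ = rows _ _ _ ij∈P ij′∈P j<j′
... | inj₂ refl = ≤-refl

entry-column-mono : ∀ {P i i′ j} → IsColumnStrict P → InShape P (i , j) → InShape P (i′ , j) → i ≤ i′ →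
                    entry P i j ≤ entry P i′ j
entry-column-mono (_ , columns) ij∈P i′j∈P i≤i′ with m≤n⇒m<n∨m≡n i≤i′
... | inj₁ i<i′ = <⇒≤ (columns _ _ _ ij∈P i′j∈P i<i′)
... | inj₂ refl = ≤-refl

entry-mono : ∀ {P c d} → IsSkewShape P → IsColumnStrict P → InShape P c → InShape P d →
             row c ≤ row d → col c ≤ col d → entryAt P c ≤ entryAt P d
entry-mono {P} {c} {d} skew strict c∈P d∈P r≤ c≤ =
  ≤-trans (entry-row-mono {P} strict c∈P corner∈P c≤) (entry-column-mono {P} strict corner∈P d∈P r≤)
  where
    corner∈P : InShape P (row c , col d)
    corner∈P = InShape-fill {P} skew c∈P d∈P r≤ c≤

module ColumnSlideScan
  (k : ℕ) (P T : Tableau) (b : Cell)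
  (skew : IsSkewShape P) (strict : IsColumnStrict P) (entries : EntriesIn k P) (b∈μ : b ∈D inner P)
  (path : ℕ → Cell) (path-0 : path 0 ≡ b)
  (path-first : ∀ m → m < k → IsFirst P (suc m) (path m) (path (suc m)))
  (T-shape⇒ : ∀ c → InShape T c → (InShape P c ⊎ c ≡ b) × c ≢ path k)
  (⇒T-shape : ∀ c → (InShape P c ⊎ c ≡ b) → c ≢ path k → InShape T c)
  (T-path : ∀ m → m < k → entryAt T (path m) ≡ suc m)
  (T-off-path : ∀ c → InShape T c → (∀ m → m < k → c ≢ path m) → entryAt T c ≡ entryAt P c)
  where

  open SlideWords k

  path∈P : ∀ {m} → m < k → InShape P (path (suc m))
  path∈P m<k = proj₁ (path-first _ m<k)

  entry-path : ∀ {m} → m < k → entryAt P (path (suc m)) ≡ suc m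
  entry-path m<k = proj₁ (proj₂ (path-first _ m<k))

  b∉P : ¬ InShape P b
  b∉P = ∉-NW-of-inner {P} (proj₁ (proj₂ skew)) b∈μ ≤-refl ≤-refl

  path-step : ∀ {m} → m < k → path (suc m) <r path m
  path-step {m} m<k with path-first m m<k
  ... | _ , _ , (col≤ , row<) , _ with m≤n⇒m<n∨m≡n col≤
  ...   | inj₁ col< = inj₁ col<
  ...   | inj₂ col≡ = inj₂ (col≡ , row<)

  path-decreasing : ∀ {m m′} → m < m′ → m′ ≤ k → path m′ <r path m
  path-decreasing {m} {suc m′} m<m′+1 m′<k with m≤n⇒m<n∨m≡n (m<1+n⇒m≤n m<m′+1)
  ... | inj₁ m<m′ = <r-trans (path-step m′<k) (path-decreasing m<m′ (<⇒≤ m′<k))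
  ... | inj₂ refl = path-step m′<k

  path-antitone : ∀ {m m′} → m ≤ m′ → m′ ≤ k → path m′ ≤r path m
  path-antitone m≤m′ m′≤k with m≤n⇒m<n∨m≡n m≤m′
  ... | inj₁ m<m′ = <r⇒≤r (path-decreasing m<m′ m′≤k)
  ... | inj₂ refl = ≤r-refl

  path-in-outer : ∀ {m} → m ≤ k → col (path m) < rowLen (outer P) (row (path m))
  path-in-outer {zero}  _     = subst (λ c → col c < rowLen (outer P) (row c)) (sym path-0)
                                  (<-≤-trans b∈μ (proj₂ (proj₂ skew) (row b)))
  path-in-outer {suc m} m+1≤k = proj₂ (path∈P m+1≤k)

  entry-NW-of-path : ∀ {j c} → j ≤ k → InShape P c →
                     row c ≤ row (path j) → col c ≤ col (path j) → entryAt P c ≤ j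
  entry-NW-of-path {zero} _ c∈P r≤ c≤ =
    ⊥-elim (∉-NW-of-inner {P} (proj₁ (proj₂ skew)) b∈μ (subst (λ q → _ ≤ row q) path-0 r≤)
                                                   (subst (λ q → _ ≤ col q) path-0 c≤) c∈P)
  entry-NW-of-path {suc j} {c} j<k c∈P r≤ c≤ =
    subst (entryAt P c ≤_) (entry-path j<k) (entry-mono {P} skew strict c∈P (path∈P j<k) r≤ c≤)

  -- This is where p_{j+1} being the first j+1 after p_j is used.
  entry-below-path : ∀ {j c} → j < k → InShape P c → path j ≺ c → entryAt P c ≡ suc j →
                     c ≤r path (suc j)
  entry-below-path {j} {c} j<k c∈P pj≺c c≡j+1 with path-first j j<k
  ... | q∈P , q≡j+1 , _ , maximal with m≤n⇒m<n∨m≡n (maximal c c∈P c≡j+1 pj≺c)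
  ...   | inj₁ col< = inj₁ col<
  ...   | inj₂ col≡ with row (path (suc j)) ≤? row c
  ...     | yes q≤c = inj₂ (col≡ , q≤c)
  ...     | no  q≰c = ⊥-elim (<-irrefl same-entry column-strict)
    where
      same-entry : entry P (row c) (col (path (suc j))) ≡ entryAt P (path (suc j))
      same-entry = trans (cong (entry P (row c)) (sym col≡)) (trans c≡j+1 (sym q≡j+1))
      column-strict : entry P (row c) (col (path (suc j))) < entryAt P (path (suc j))
      column-strict = proj₂ strict _ _ _ (subst (λ x → InShape P (row c , x)) col≡ c∈P) q∈P (≰⇒> q≰c)

  entry-between-path : ∀ {j c} → j < k → InShape P c → c ≤r path j → ¬ c ≤r path (suc j) →
                       entryAt P c ≢ suc j
  entry-between-path {j} {c} j<k c∈P c≤pj c≰pj+1 c≡j+1 with row c ≤? row (path j)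
  ... | yes r≤ = <-irrefl c≡j+1 (s≤s (entry-NW-of-path (<⇒≤ j<k) c∈P r≤ (≤r⇒col≤ c≤pj)))
  ... | no  r≰ = c≰pj+1 (entry-below-path j<k c∈P (≤r⇒col≤ c≤pj , ≰⇒> r≰) c≡j+1)

  path∈P∪b : ∀ {n} → n < k → InShape P (path n) ⊎ path n ≡ b
  path∈P∪b {zero}  _   = inj₂ path-0
  path∈P∪b {suc n} n<k = inj₁ (path∈P (<-trans (n<1+n n) n<k))

  OffPath : Cell → Set
  OffPath c = ∀ m → m ≤ k → c ≢ path m

  cellWord-P-path : ∀ {n} → n ≤ k → cellWord P (path n) ≡ pathLetterP n
  cellWord-P-path {zero}  _   = cellWord-out P (path 0) (subst (λ c → ¬ InShape P c) (sym path-0) b∉P)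
  cellWord-P-path {suc n} n<k = trans (cellWord-in P _ (path∈P n<k)) (cong (_∷ []) (entry-path n<k))

  cellWord-T-path : ∀ {n} → n ≤ k → cellWord T (path n) ≡ pathLetterT n
  cellWord-T-path {n} n≤k with n ≟ k
  ... | yes refl = cellWord-out T (path n) (λ pn∈T → proj₂ (T-shape⇒ (path n) pn∈T) refl)
  ... | no  n≢k  = trans (cellWord-in T (path n) pn∈T) (cong (_∷ []) (T-path n n<k))
    where
      n<k : n < k
      n<k = ≤∧≢⇒< n≤k n≢k
      pn∈T : InShape T (path n)
      pn∈T = ⇒T-shape (path n) (path∈P∪b n<k) (λ eq → <r⇒≢ (path-decreasing n<k ≤-refl) (sym eq))

  cellWord-T-off-path : ∀ {c} → OffPath c → cellWord T c ≡ cellWord P c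
  cellWord-T-off-path {c} off with InShape? P c
  ... | yes c∈P =
    trans (cellWord-in T c c∈T) (trans (cong (_∷ []) same-entry) (sym (cellWord-in P c c∈P)))
    where
      c∈T : InShape T c
      c∈T = ⇒T-shape c (inj₁ c∈P) (off k ≤-refl)
      same-entry : entryAt T c ≡ entryAt P c
      same-entry = T-off-path c c∈T (λ m m<k → off m (<⇒≤ m<k))
  ... | no c∉P = trans (cellWord-out T c c∉T) (sym (cellWord-out P c c∉P))
    where
      c∉T : ¬ InShape T c
      c∉T c∈T with proj₁ (T-shape⇒ c c∈T)
      ... | inj₁ c∈P = c∉P c∈P
      ... | inj₂ c≡b = off 0 z≤n (trans c≡b (sym path-0))

  r : ℕ
  r = length (outer P) + length (outer T)

  N : ℕ
  N = maxList (outer P) + maxList (outer T)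

  open ReadingBox r

  path-row≤ : ∀ {m} → m ≤ k → row (path m) ≤ r
  path-row≤ m≤k =
    ≤-trans (<⇒≤ (rowLen>0⇒<length (outer P) _ (≤-<-trans z≤n (path-in-outer m≤k)))) (m≤m+n _ _)

  path-col< : ∀ {m} → m ≤ k → col (path m) < N
  path-col< m≤k = <-≤-trans (path-in-outer m≤k) (≤-trans (rowLen≤maxList (outer P) _) (m≤m+n _ _))

  -- The cells read from c onwards contain p₀, …, p_{n-1} but not p_n.
  StageAt : ℕ → Cell → Set
  StageAt n c = n ≤ suc k × (∀ m → m < n → c ≤r path m) × (n ≤ k → ¬ c ≤r path n)

  StageAt-end : StageAt 0 (r , N)
  StageAt-end = z≤n , (λ _ ()) , λ _ → <r⇒≱r (inj₁ (path-col< z≤n))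

  StageAt-start : ∀ {n} → StageAt n (r , 0) → n ≡ suc k
  StageAt-start {n} (n≤k+1 , _ , unread) with m≤n⇒m<n∨m≡n n≤k+1
  ... | inj₂ n≡k+1 = n≡k+1
  ... | inj₁ n<k+1 with m≤n⇒m<n∨m≡n (z≤n {col (path n)})
  ...   | inj₁ 0<col = ⊥-elim (unread (m<1+n⇒m≤n n<k+1) (inj₁ 0<col))
  ...   | inj₂ 0≡col =
    ⊥-elim (unread (m<1+n⇒m≤n n<k+1) (inj₂ (0≡col , path-row≤ (m<1+n⇒m≤n n<k+1))))

  StageAt-path : ∀ {n} → n ≤ k → StageAt (suc n) (path n)
  StageAt-path n≤k =
    s≤s n≤k , (λ m m<n+1 → path-antitone (m<1+n⇒m≤n m<n+1) n≤k) ,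
    λ n+1≤k → <r⇒≱r (path-decreasing ≤-refl n+1≤k)

  StageAt-prev : ∀ {n c} → StageAt n (next c) → (n ≤ k → c ≢ path n) → StageAt n c
  StageAt-prev {n} {c} (n≤k+1 , read , unread) c≢pn =
    n≤k+1 , (λ m m<n → <r⇒≤r (<r-≤r-trans (<r-next c) (read m m<n))) , not-read
    where
      not-read : n ≤ k → ¬ c ≤r path n
      not-read n≤k c≤pn with ≤r⇒≡⊎next≤r c c≤pn (path-row≤ n≤k)
      ... | inj₁ c≡pn    = c≢pn n≤k c≡pn
      ... | inj₂ next≤pn = unread n≤k next≤pn

  OffPath-prev : ∀ {n c} → StageAt n (next c) → (n ≤ k → c ≢ path n) → OffPath c
  OffPath-prev {n} {c} st c≢pn m m≤k c≡pm with <-cmp m n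
  ... | tri< m<n _ _ = <r⇒≢ (<r-≤r-trans (<r-next c) (proj₁ (proj₂ st) m m<n)) c≡pm
  ... | tri≈ _ refl _ = c≢pn m≤k c≡pm
  ... | tri> _ _ n<m = proj₂ (proj₂ (StageAt-prev st c≢pn)) (<⇒≤ (<-≤-trans n<m m≤k))
                         (subst (_≤r path n) (sym c≡pm) (path-antitone (<⇒≤ n<m) m≤k))

  admissible : ∀ {n c} → StageAt n c → InShape P c → Admissible n (entryAt P c)
  admissible {zero}  _                   _   = tt
  admissible {suc j} {c} (_ , read , unread) c∈P j<k =
    proj₁ (entries c c∈P) , proj₂ (entries c c∈P) ,
    entry-between-path j<k c∈P (read j ≤-refl) (unread j<k)

  stage-off-path : ∀ {n c u v} → StageAt n c → OffPath c → Stage n u v →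
                   Stage n (cellWord P c ++ u) (cellWord T c ++ v)
  stage-off-path {c = c} st off S rewrite cellWord-T-off-path off with InShape? P c
  ... | yes c∈P rewrite cellWord-in P c c∈P  = stage-letter _ (admissible st c∈P) S
  ... | no  c∉P rewrite cellWord-out P c c∉P = S

  stage-on-path : ∀ {n u v} → n ≤ k → Stage n u v →
                  Stage (suc n) (cellWord P (path n) ++ u) (cellWord T (path n) ++ v)
  stage-on-path n≤k S rewrite cellWord-P-path n≤k | cellWord-T-path n≤k = stage-path n≤k S

  scan-off-path : ∀ {n c d u v} → next c ≡ d → StageAt n d → (n ≤ k → c ≢ path n) → Stage n u v →
                  StageAt n c × Stage n (cellWord P c ++ u) (cellWord T c ++ v)
  scan-off-path refl st c≢pn S =
    StageAt-prev st c≢pn , stage-off-path (StageAt-prev st c≢pn) (OffPath-prev st c≢pn) S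

  scan : ∀ L → Contiguous (r , N) L → ∃ λ n →
         StageAt n (headOr (r , N) L) × Stage n (concatMap (cellWord P) L) (concatMap (cellWord T) L)
  scan []      _            = 0 , StageAt-end , before ε
  scan (c ∷ L) (next≡ , L↑) with scan L L↑
  ... | n , st , S with n ≤? k | ≡-dec _≟_ _≟_ c (path n)
  ...   | yes n≤k | yes refl = suc n , StageAt-path n≤k , stage-on-path n≤k S
  ...   | yes _   | no  c≢pn = n , scan-off-path next≡ st (λ _ → c≢pn) S
  ...   | no  n≰k | _        = n , scan-off-path next≡ st (λ n≤k → ⊥-elim (n≰k n≤k)) S

  box-stage : Stage (suc k) (boxWord P (suc r) N) (boxWord T (suc r) N)
  box-stage with boxCells-contiguous N
  ... | box↑ , box-head with scan (boxCells (suc r) N) box↑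
  ...   | n , st , S = subst (λ n → Stage n _ _) (StageAt-start (subst (StageAt n) box-head st)) S

  readingWord-P : readingWord P ≡ boxWord P (suc r) N
  readingWord-P =
    readingWord≡boxWord P (≤-trans (m≤m+n _ (length (outer T))) (n≤1+n r)) (m≤m+n _ (maxList (outer T)))

  readingWord-T : readingWord T ≡ boxWord T (suc r) N
  readingWord-T =
    readingWord≡boxWord T (≤-trans (m≤n+m _ (length (outer P))) (n≤1+n r)) (m≤n+m _ (maxList (outer P)))

lemma7p1 : (k : ℕ) (P : Tableau) (b : Cell) →
    IsSkewShape P → IsColumnStrict P → EntriesIn k P →
    IsInnerCorner P b → PermissibleAt k P b →
    (T : Tableau) → ColumnSlide k P b T → TabKnuthEquivalent T P
lemma7p1 k P b skew strict entries corner _ T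
         (path , path-0 , path-first , T-shape⇒ , ⇒T-shape , T-path , T-off-path) =
  subst₂ _≈_ (sym readingWord-T) (sym readingWord-P) (≈-sym (SlideWords.Stage-after k box-stage))
  where
    open ColumnSlideScan k P T b skew strict entries (proj₁ corner)
                         path path-0 path-first T-shape⇒ ⇒T-shape T-path T-off-path
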